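{- For all terms $t,s$: $t\approx_{\mathrm{nf}} s$ if and only if there exists a natural number $n>\max(\mathrm{fv}(t)\cup\mathrm{fv}(s))$ such that $\langle t,[\,],n\rangle_{\mathsf{ev}}\approx_{\mathrm m}\langle s,[\,],n\rangle_{\mathsf{ev}}$ in the call-by-value NFB machine.
   Context: Call-by-value terms with free and bound variables: $t,s ::= f\mid x\mid\lambda x.t\mid t\,s$ and values $v ::= f\mid\lambda x.t$, where free variables $f$ are natural numbers and bound variables $x$ must be bound (well formed terms). $\mathrm{fv}(t)$ is the set of free variables of $t$; $f$ is fresh if it occurs in no entity under consideration. Stacks $\pi ::= \mathsf{arg}(t)::\pi\mid\mathsf{fun}(v)::\pi\mid[\,]$. CK machine: configurations $\langle t,\pi\rangle_{\mathsf{ev}}$ and $\langle\pi,v\rangle_{\mathsf{cont}}$, transitions $\langle t\,s,\pi\rangle_{\mathsf{ev}}\to\langle t,\mathsf{arg}(s)::\pi\rangle_{\mathsf{ev}}$; $\langle v,\pi\rangle_{\mathsf{ev}}\to\langle\pi,v\rangle_{\mathsf{cont}}$; $\langle\mathsf{arg}(t)::\pi,v\rangle_{\mathsf{cont}}\to\langle t,\mathsf{fun}(v)::\pi\rangle_{\mathsf{ev}}$; $\langle\mathsf{fun}(\lambda x.t)::\pi,v\rangle_{\mathsf{cont}}\to\langle t\{v/x\},\pi\rangle_{\mathsf{ev}}$. Normal-form bisimilarity (on CK configurations): a symmetric relation $\mathcal R$ on configurations is a normal-form bisimulation if $C\mathcal R C'$ implies: (1) if $C\to^*\langle[\,],v\rangle_{\mathsf{cont}}$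 then there is $v'$ with $C'\to^*\langle[\,],v'\rangle_{\mathsf{cont}}$ and, for all fresh $f$, $\langle\mathsf{fun}(v)::[\,],f\rangle_{\mathsf{cont}}\,\mathcal R\,\langle\mathsf{fun}(v')::[\,],f\rangle_{\mathsf{cont}}$; (2) if $C\to^*\langle\mathsf{fun}(f)::\pi,v\rangle_{\mathsf{cont}}$ then there are $\pi',v'$ with $C'\to^*\langle\mathsf{fun}(f)::\pi',v'\rangle_{\mathsf{cont}}$ and, for all fresh $f'$, $\langle\mathsf{fun}(v)::[\,],f'\rangle_{\mathsf{cont}}\,\mathcal R\,\langle\mathsf{fun}(v')::[\,],f'\rangle_{\mathsf{cont}}$ and $\langle\pi,f'\rangle_{\mathsf{cont}}\,\mathcal R\,\langle\pi',f'\rangle_{\mathsf{cont}}$. Let $\approx_{\mathrm{nf}}$ be the largest normal-form bisimulation, extended to terms by $t\approx_{\mathrm{nf}}s$ iff $\langle t,[\,]\rangle_{\mathsf{ev}}\approx_{\mathrm{nf}}\langle s,[\,]\rangle_{\mathsf{ev}}$. Call-by-value NFB machine: configurations $\langle t,\pi,n\rangle_{\mathsf{ev}}$ and $\langle\pi,v,n\rangle_{\mathsf{cont}}$, $n\in\mathbb N$. Transitions: $\langle t\,s,\pi,n\rangle_{\mathsf{ev}}\xrightarrow{\tau}\langle t,\mathsf{arg}(s)::\pi,n\rangle_{\mathsf{ev}}$; $\langle v,\pi,n\rangle_{\mathsf{ev}}\xrightarrow{\tau}\langle\pi,v,n\rangle_{\mathsf{cont}}$; $\langle\mathsf{arg}(t)::\pi,v,n\rangle_{\mathsf{cont}}\xrightarrow{\tau}\langle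 t,\mathsf{fun}(v)::\pi,n\rangle_{\mathsf{ev}}$; $\langle\mathsf{fun}(\lambda x.t)::\pi,v,n\rangle_{\mathsf{cont}}\xrightarrow{\tau}\langle t\{v/x\},\pi,n\rangle_{\mathsf{ev}}$; $\langle[\,],v,n\rangle_{\mathsf{cont}}\xrightarrow{\lambda}\langle\mathsf{fun}(v)::[\,],n,n+1\rangle_{\mathsf{cont}}$; $\langle\mathsf{fun}(f)::\pi,v,n\rangle_{\mathsf{cont}}\xrightarrow{f}\xrightarrow{\mathsf{val}}\langle\mathsf{fun}(v)::[\,],n,n+1\rangle_{\mathsf{cont}}$; $\langle\mathsf{fun}(f)::\pi,v,n\rangle_{\mathsf{cont}}\xrightarrow{f}\xrightarrow{\mathsf{ctx}}\langle\pi,n,n+1\rangle_{\mathsf{cont}}$, where $\xrightarrow{f}\xrightarrow{F}$ denotes a transition flagged by the free variable $f$ followed by a transition flagged $F$ (through an intermediate state). Machine bisimilarity: with $F$ ranging over flags (non-$\tau$ labels), a symmetric $\mathcal R$ on machine states is a machine bisimulation if $C_1\mathcal R C_2$ implies: if $C_1\xrightarrow{\tau}^*\xrightarrow{F}C_1'$ then $C_2\xrightarrow{\tau}^*\xrightarrow{F}C_2'$ for some $C_2'$ with $C_1'\mathcal R C_2'$; and if $C_1\xrightarrow{\tau}^*\xrightarrow{F}$ by a terminating transition then so does $C_2$. $\approx_{\mathrm m}$ is the largest machine bisimulation. -}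

module Defs where

open import Data.Nat using (ℕ; zero; suc; _<_)
open import Data.Fin using (Fin; zero; suc)
open import Data.List using (List; []; _∷_)
open import Data.Product using (Σ; _×_; _,_; ∃)
open import Data.Sum using (_⊎_)
open import Data.Empty using (⊥)
open import Data.Unit using (⊤)
open import Relation.Nullary using (¬_)
open import Relation.Binary.PropositionalEquality using (_≡_)
open import Relation.Binary.Construct.Closure.ReflexiveTransitive using (Star)

-- Free variables are natural numbers (fvar f); bound variables
-- are de Bruijn indices into the current scope of binders (bvar i), so
-- a term of type  Tm k  has at most k enclosing-binder indices and the
-- well-formed terms of the paper are exactly  Tm 0.

data Tm (k : ℕ) : Set where
  fvar : ℕ → Tm k
  bvar : Fin k → Tm k
  lam  : Tm (suc k) → Tm k
  app  : Tm k → Tm k → Tm k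

Term : Set
Term = Tm 0

ext : ∀ {m n} → (Fin m → Fin n) → Fin (suc m) → Fin (suc n)
ext ρ zero    = zero
ext ρ (suc i) = suc (ρ i)

ren : ∀ {m n} → (Fin m → Fin n) → Tm m → Tm n
ren ρ (fvar f)  = fvar f
ren ρ (bvar i)  = bvar (ρ i)
ren ρ (lam t)   = lam (ren (ext ρ) t)
ren ρ (app t s) = app (ren ρ t) (ren ρ s)

exts : ∀ {m n} → (Fin m → Tm n) → Fin (suc m) → Tm (suc n)
exts σ zero    = bvar zero
exts σ (suc i) = ren suc (σ i)

sub : ∀ {m n} → (Fin m → Tm n) → Tm m → Tm n
sub σ (fvar f)  = fvar f
sub σ (bvar i)  = σ i
sub σ (lam t)   = lam (sub (exts σ) t)
sub σ (app t s) = app (sub σ t) (sub σ s)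

data Val : Set where
  vf   : ℕ → Val
  vlam : Tm 1 → Val

⌜_⌝ : Val → Term
⌜ vf f ⌝   = fvar f
⌜ vlam t ⌝ = lam t

_[_/0] : Tm 1 → Val → Term
t [ v /0] = sub (λ { zero → ⌜ v ⌝ }) t

data Frame : Set where
  arg : Term → Frame
  fun : Val → Frame

Stack : Set
Stack = List Frame

data _∈fvTm_ {k : ℕ} (f : ℕ) : Tm k → Set where
  here  : f ∈fvTm fvar f
  inlam : ∀ {t} → f ∈fvTm t → f ∈fvTm lam t
  appl  : ∀ {t s} → f ∈fvTm t → f ∈fvTm app t s
  appr  : ∀ {t s} → f ∈fvTm s → f ∈fvTm app t s

_∈fvV_ : ℕ → Val → Set
f ∈fvV v = f ∈fvTm ⌜ v ⌝

_∈fvF_ : ℕ → Frame → Set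
f ∈fvF arg t = f ∈fvTm t
f ∈fvF fun v = f ∈fvV v

_∈fvS_ : ℕ → Stack → Set
f ∈fvS []      = ⊥
f ∈fvS (φ ∷ π) = f ∈fvF φ ⊎ f ∈fvS π

data Conf : Set where
  ev   : Term → Stack → Conf
  cont : Stack → Val → Conf

_∈fvC_ : ℕ → Conf → Set
f ∈fvC ev t π   = f ∈fvTm t ⊎ f ∈fvS π
f ∈fvC cont π v = f ∈fvS π ⊎ f ∈fvV v

data _⟶_ : Conf → Conf → Set where
  ck-app  : ∀ {t s π} → ev (app t s) π ⟶ ev t (arg s ∷ π)
  ck-val  : ∀ {v π} → ev ⌜ v ⌝ π ⟶ cont π v
  ck-arg  : ∀ {t π v} → cont (arg t ∷ π) v ⟶ ev t (fun v ∷ π)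
  ck-beta : ∀ {t π v} → cont (fun (vlam t) ∷ π) v ⟶ ev (t [ v /0]) π

_⟶*_ : Conf → Conf → Set
_⟶*_ = Star _⟶_

FreshC : ℕ → List Conf → Set
FreshC f []       = ⊤
FreshC f (C ∷ Cs) = ¬ (f ∈fvC C) × FreshC f Cs

Symmetric : {A : Set} → (A → A → Set) → Set
Symmetric R = ∀ {x y} → R x y → R y x

-- Normal-form bisimulation.  "Fresh" means: occurring in none of the
-- entities under consideration, i.e. C, C', v, v' (and π, π').
record IsNFBisim (R : Conf → Conf → Set) : Set where
  field
    symm : Symmetric R
    clause1 : ∀ {C C' v} → R C C' → C ⟶* cont [] v →
      Σ Val λ v' → (C' ⟶* cont [] v') ×
        (∀ f → FreshC f (C ∷ C' ∷ cont [] v ∷ cont [] v' ∷ []) →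
           R (cont (fun v ∷ []) (vf f)) (cont (fun v' ∷ []) (vf f)))
    clause2 : ∀ {C C' f π v} → R C C' → C ⟶* cont (fun (vf f) ∷ π) v →
      Σ Stack λ π' → Σ Val λ v' → (C' ⟶* cont (fun (vf f) ∷ π') v') ×
        (∀ f' → FreshC f' (C ∷ C' ∷ cont (fun (vf f) ∷ π) v
                              ∷ cont (fun (vf f) ∷ π') v' ∷ []) →
           R (cont (fun v ∷ []) (vf f')) (cont (fun v' ∷ []) (vf f'))
           × R (cont π (vf f')) (cont π' (vf f')))

_≈nfC_ : Conf → Conf → Set₁
C ≈nfC C' = Σ (Conf → Conf → Set) λ R → IsNFBisim R × R C C'

_≈nf_ : Term → Term → Set₁
t ≈nf s = ev t [] ≈nfC ev s []

data MState : Set where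
  mev   : Term → Stack → ℕ → MState
  mcont : Stack → Val → ℕ → MState
  -- intermediate state after the f-flagged transition from
  -- ⟨fun(f)::π, v, n⟩_cont, before the val / ctx flagged transition
  mmid  : Stack → Val → ℕ → MState

data Flag : Set where
  λF   : Flag
  varF : ℕ → Flag
  valF : Flag
  ctxF : Flag

data Label : Set where
  τ    : Label
  flag : Flag → Label

data _—[_]→_ : MState → Label → MState → Set where
  m-app  : ∀ {t s π n} → mev (app t s) π n —[ τ ]→ mev t (arg s ∷ π) n
  m-val  : ∀ {v π n} → mev ⌜ v ⌝ π n —[ τ ]→ mcont π v n
  m-arg  : ∀ {t π v n} → mcont (arg t ∷ π) v n —[ τ ]→ mev t (fun v ∷ π) n
  m-beta : ∀ {t π v n} → mcont (fun (vlam t) ∷ π) v n —[ τ ]→ mev (t [ v /0]) π n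
  m-lam  : ∀ {v n} → mcont [] v n —[ flag λF ]→ mcont (fun v ∷ []) (vf n) (suc n)
  m-var  : ∀ {f π v n} → mcont (fun (vf f) ∷ π) v n —[ flag (varF f) ]→ mmid π v n
  m-fval : ∀ {π v n} → mmid π v n —[ flag valF ]→ mcont (fun v ∷ []) (vf n) (suc n)
  m-fctx : ∀ {π v n} → mmid π v n —[ flag ctxF ]→ mcont π (vf n) (suc n)

-- terminating (flagged) transitions: the CBV NFB machine has none
data _—[_]→∎ : MState → Label → Set where

_—τ→_ : MState → MState → Set
C —τ→ C' = C —[ τ ]→ C'

_—τ*→_ : MState → MState → Set
_—τ*→_ = Star _—τ→_

_⇒[_]_ : MState → Flag → MState → Set
C ⇒[ F ] C' = Σ MState λ C'' → (C —τ*→ C'') × (C'' —[ flag F ]→ C')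

_⇒[_]∎ : MState → Flag → Set
C ⇒[ F ]∎ = Σ MState λ C'' → (C —τ*→ C'') × (C'' —[ flag F ]→∎)

record IsMBisim (R : MState → MState → Set) : Set where
  field
    symm  : Symmetric R
    step  : ∀ {C₁ C₂ F C₁'} → R C₁ C₂ → C₁ ⇒[ F ] C₁' →
      Σ MState λ C₂' → (C₂ ⇒[ F ] C₂') × R C₁' C₂'
    final : ∀ {C₁ C₂ F} → R C₁ C₂ → C₁ ⇒[ F ]∎ → C₂ ⇒[ F ]∎

_≈m_ : MState → MState → Set₁
C ≈m C' = Σ (MState → MState → Set) λ R → IsMBisim R × R C C'

AboveFV : ℕ → Term → Term → Set
AboveFV n t s = ∀ f → f ∈fvTm t ⊎ f ∈fvTm s → f < n

-- (⇒) Start the machine with its counter n above every free variable.  Each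
-- flagged transition then introduces the name n, fresh for everything reached
-- so far, and increments the counter; so a normal-form bisimulation, restricted
-- to configurations whose free variables lie below the counter, is a machine
-- bisimulation.
-- (⇐) The machine only tests with the particular fresh names n, n+1, …, while
-- normal-form bisimilarity quantifies over all fresh f.  Relate two CK
-- configurations when an injective renaming of their free variables into the
-- names below some counter makes the corresponding machine states bisimilar.
-- CK reduction commutes with renaming and is deterministic, so CK runs and the
-- machine runs of their renamings match up, and a fresh f is simply renamed to
-- the counter.  Injectivity identifies the head variables in clause (2).

module Submission where

open import Defs
open import Data.Nat using (ℕ; zero; suc; _<_; _⊔_)
open import Data.Nat.Properties using (_≟_; <-irrefl; n<1+n; m<n⇒m<1+n; <-≤-trans; m≤m⊔n; m≤n⊔m)
open import Data.Fin using (Fin; zero; suc)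
open import Data.List using ([]; _∷_; map)
open import Data.Product using (Σ; _×_; _,_; proj₁; proj₂)
open import Data.Sum using (_⊎_; inj₁; inj₂; swap)
open import Data.Empty using (⊥-elim)
open import Data.Unit using (tt)
open import Relation.Nullary using (¬_; yes; no)
open import Level using (0ℓ)
open import Relation.Unary using (Pred; _⊆_; _∪_)
open import Relation.Binary.PropositionalEquality using (_≡_; _≢_; refl; sym; trans; cong; cong₂; subst; subst₂)
open import Relation.Binary.Construct.Closure.ReflexiveTransitive using (ε; _◅_; gmap)
open import Function.Bundles using (_⇔_; mk⇔)

renameTm : ∀ {k} → (ℕ → ℕ) → Tm k → Tm k
renameTm ρ (fvar f)  = fvar (ρ f)
renameTm ρ (bvar i)  = bvar i
renameTm ρ (lam t)   = lam (renameTm ρ t)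
renameTm ρ (app t s) = app (renameTm ρ t) (renameTm ρ s)

renameVal : (ℕ → ℕ) → Val → Val
renameVal ρ (vf f)   = vf (ρ f)
renameVal ρ (vlam t) = vlam (renameTm ρ t)

renameFrame : (ℕ → ℕ) → Frame → Frame
renameFrame ρ (arg t) = arg (renameTm ρ t)
renameFrame ρ (fun v) = fun (renameVal ρ v)

renameStack : (ℕ → ℕ) → Stack → Stack
renameStack ρ = map (renameFrame ρ)

renameConf : (ℕ → ℕ) → Conf → Conf
renameConf ρ (ev t π)   = ev (renameTm ρ t) (renameStack ρ π)
renameConf ρ (cont π v) = cont (renameStack ρ π) (renameVal ρ v)

renameTm-ren : ∀ {m n} ρ (r : Fin m → Fin n) (t : Tm m) →
  renameTm ρ (ren r t) ≡ ren r (renameTm ρ t)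
renameTm-ren ρ r (fvar f)  = refl
renameTm-ren ρ r (bvar i)  = refl
renameTm-ren ρ r (lam t)   = cong lam (renameTm-ren ρ (ext r) t)
renameTm-ren ρ r (app t s) = cong₂ app (renameTm-ren ρ r t) (renameTm-ren ρ r s)

renameTm-sub : ∀ {m n} ρ {σ σ' : Fin m → Tm n} → (∀ i → renameTm ρ (σ i) ≡ σ' i) →
  (t : Tm m) → renameTm ρ (sub σ t) ≡ sub σ' (renameTm ρ t)
renameTm-sub ρ eq (fvar f)  = refl
renameTm-sub ρ eq (bvar i)  = eq i
renameTm-sub ρ {σ} {σ'} eq (lam t) = cong lam (renameTm-sub ρ exts-eq t)
  where
  exts-eq : ∀ i → renameTm ρ (exts σ i) ≡ exts σ' i
  exts-eq zero    = refl
  exts-eq (suc i) = trans (renameTm-ren ρ suc (σ i)) (cong (ren suc) (eq i))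
renameTm-sub ρ eq (app t s) = cong₂ app (renameTm-sub ρ eq t) (renameTm-sub ρ eq s)

renameTm-⌜⌝ : ∀ ρ v → renameTm ρ ⌜ v ⌝ ≡ ⌜ renameVal ρ v ⌝
renameTm-⌜⌝ ρ (vf f)   = refl
renameTm-⌜⌝ ρ (vlam t) = refl

renameTm-[/0] : ∀ ρ (t : Tm 1) v → renameTm ρ (t [ v /0]) ≡ renameTm ρ t [ renameVal ρ v /0]
renameTm-[/0] ρ t v = renameTm-sub ρ (λ { zero → renameTm-⌜⌝ ρ v }) t

renameTm-id : ∀ {k} (t : Tm k) → renameTm (λ x → x) t ≡ t
renameTm-id (fvar f)  = refl
renameTm-id (bvar i)  = refl
renameTm-id (lam t)   = cong lam (renameTm-id t)
renameTm-id (app t s) = cong₂ app (renameTm-id t) (renameTm-id s)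

renameTm-cong : ∀ {k ρ ρ'} (t : Tm k) → (∀ {x} → x ∈fvTm t → ρ x ≡ ρ' x) →
  renameTm ρ t ≡ renameTm ρ' t
renameTm-cong (fvar f)  eq = cong fvar (eq here)
renameTm-cong (bvar i)  eq = refl
renameTm-cong (lam t)   eq = cong lam (renameTm-cong t (λ h → eq (inlam h)))
renameTm-cong (app t s) eq =
  cong₂ app (renameTm-cong t (λ h → eq (appl h))) (renameTm-cong s (λ h → eq (appr h)))

renameVal-cong : ∀ {ρ ρ'} v → (∀ {x} → x ∈fvV v → ρ x ≡ ρ' x) → renameVal ρ v ≡ renameVal ρ' v
renameVal-cong (vf f)   eq = cong vf (eq here)
renameVal-cong (vlam t) eq = cong vlam (renameTm-cong t (λ h → eq (inlam h)))

renameFrame-cong : ∀ {ρ ρ'} φ → (∀ {x} → x ∈fvF φ → ρ x ≡ ρ' x) →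
  renameFrame ρ φ ≡ renameFrame ρ' φ
renameFrame-cong (arg t) eq = cong arg (renameTm-cong t eq)
renameFrame-cong (fun v) eq = cong fun (renameVal-cong v eq)

renameStack-cong : ∀ {ρ ρ'} π → (∀ {x} → x ∈fvS π → ρ x ≡ ρ' x) →
  renameStack ρ π ≡ renameStack ρ' π
renameStack-cong []      eq = refl
renameStack-cong (φ ∷ π) eq =
  cong₂ _∷_ (renameFrame-cong φ (λ h → eq (inj₁ h))) (renameStack-cong π (λ h → eq (inj₂ h)))

renameConf-⟶ : ∀ ρ {C D} → C ⟶ D → renameConf ρ C ⟶ renameConf ρ D
renameConf-⟶ ρ ck-app            = ck-app
renameConf-⟶ ρ (ck-val {vf f})   = ck-val {vf (ρ f)}
renameConf-⟶ ρ (ck-val {vlam t}) = ck-val {vlam (renameTm ρ t)}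
renameConf-⟶ ρ ck-arg            = ck-arg
renameConf-⟶ ρ (ck-beta {t} {π} {v}) =
  subst (λ u → cont (fun (vlam (renameTm ρ t)) ∷ renameStack ρ π) (renameVal ρ v) ⟶ ev u (renameStack ρ π))
        (sym (renameTm-[/0] ρ t v)) ck-beta

renameConf-⟶* : ∀ ρ {C D} → C ⟶* D → renameConf ρ C ⟶* renameConf ρ D
renameConf-⟶* ρ = gmap (renameConf ρ) (renameConf-⟶ ρ)

-- Only meaningful on configurations that can step.
next : Conf → Conf
next (ev (fvar f) π)             = cont π (vf f)
next (ev (lam t) π)              = cont π (vlam t)
next (ev (app t s) π)            = ev t (arg s ∷ π)
next (cont (arg t ∷ π) v)        = ev t (fun v ∷ π)
next (cont (fun (vlam t) ∷ π) v) = ev (t [ v /0]) π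
next C                           = C

⟶-next : ∀ {C D} → C ⟶ D → D ≡ next C
⟶-next ck-app            = refl
⟶-next (ck-val {vf f})   = refl
⟶-next (ck-val {vlam t}) = refl
⟶-next ck-arg            = refl
⟶-next ck-beta           = refl

⟶-deterministic : ∀ {C D₁ D₂} → C ⟶ D₁ → C ⟶ D₂ → D₁ ≡ D₂
⟶-deterministic p q = trans (⟶-next p) (sym (⟶-next q))

data Stuck : Conf → Set where
  answer  : ∀ {v} → Stuck (cont [] v)
  var-app : ∀ {f π v} → Stuck (cont (fun (vf f) ∷ π) v)

Stuck-¬⟶ : ∀ {C D} → Stuck C → ¬ (C ⟶ D)
Stuck-¬⟶ answer  ()
Stuck-¬⟶ var-app ()

Stuck-rename : ∀ ρ {C} → Stuck C → Stuck (renameConf ρ C)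
Stuck-rename ρ answer  = answer
Stuck-rename ρ var-app = var-app

progress : ∀ C → Stuck C ⊎ Σ Conf (C ⟶_)
progress (ev (fvar f) π)             = inj₂ (_ , ck-val {vf f})
progress (ev (lam t) π)              = inj₂ (_ , ck-val {vlam t})
progress (ev (app t s) π)            = inj₂ (_ , ck-app)
progress (cont [] v)                 = inj₁ answer
progress (cont (arg t ∷ π) v)        = inj₂ (_ , ck-arg)
progress (cont (fun (vf f) ∷ π) v)   = inj₁ var-app
progress (cont (fun (vlam t) ∷ π) v) = inj₂ (_ , ck-beta)

-- Holds for any ρ, injective or not: the renamed run is forced step by step by
-- determinism, and it cannot continue past a renamed stuck configuration.
renameConf-⟶*⁻ : ∀ ρ C {X} → renameConf ρ C ⟶* X → Σ Conf λ D → C ⟶* D × renameConf ρ D ≡ X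
renameConf-⟶*⁻ ρ C ε = C , ε , refl
renameConf-⟶*⁻ ρ C (p ◅ ps) with progress C
... | inj₁ stuck = ⊥-elim (Stuck-¬⟶ (Stuck-rename ρ stuck) p)
... | inj₂ (D , q) with ⟶-deterministic p (renameConf-⟶ ρ q)
... | refl with renameConf-⟶*⁻ ρ D ps
... | E , qs , eq = E , q ◅ qs , eq

renameConf-≡-answer : ∀ ρ D {w} → renameConf ρ D ≡ cont [] w →
  Σ Val λ v → D ≡ cont [] v × renameVal ρ v ≡ w
renameConf-≡-answer ρ (cont [] v) refl = v , refl , refl

renameConf-≡-var-app : ∀ ρ D {g σ w} → renameConf ρ D ≡ cont (fun (vf g) ∷ σ) w →
  Σ ℕ λ f → Σ Stack λ π → Σ Val λ v →
    D ≡ cont (fun (vf f) ∷ π) v × ρ f ≡ g × renameStack ρ π ≡ σ × renameVal ρ v ≡ w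
renameConf-≡-var-app ρ (cont (fun (vf f) ∷ π) v) refl = f , π , v , refl , refl , refl , refl

ren-fv⊆ : ∀ {m n} (r : Fin m → Fin n) (t : Tm m) → (_∈fvTm ren r t) ⊆ (_∈fvTm t)
ren-fv⊆ r (fvar f)  here      = here
ren-fv⊆ r (lam t)   (inlam h) = inlam (ren-fv⊆ (ext r) t h)
ren-fv⊆ r (app t s) (appl h)  = appl (ren-fv⊆ r t h)
ren-fv⊆ r (app t s) (appr h)  = appr (ren-fv⊆ r s h)

sub-fv⊆ : ∀ {m n} (σ : Fin m → Tm n) (t : Tm m) {x} → x ∈fvTm sub σ t →
  x ∈fvTm t ⊎ Σ (Fin m) λ i → x ∈fvTm σ i
sub-fv⊆ σ (fvar f) here = inj₁ here
sub-fv⊆ σ (bvar i) h    = inj₂ (i , h)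
sub-fv⊆ σ (lam t) (inlam h) with sub-fv⊆ (exts σ) t h
... | inj₁ p           = inj₁ (inlam p)
... | inj₂ (suc i , p) = inj₂ (i , ren-fv⊆ suc (σ i) p)
sub-fv⊆ σ (app t s) (appl h) with sub-fv⊆ σ t h
... | inj₁ p = inj₁ (appl p)
... | inj₂ q = inj₂ q
sub-fv⊆ σ (app t s) (appr h) with sub-fv⊆ σ s h
... | inj₁ p = inj₁ (appr p)
... | inj₂ q = inj₂ q

⟶-fv⊆ : ∀ {C D} → C ⟶ D → (_∈fvC D) ⊆ (_∈fvC C)
⟶-fv⊆ ck-app (inj₁ h)          = inj₁ (appl h)
⟶-fv⊆ ck-app (inj₂ (inj₁ h))   = inj₁ (appr h)
⟶-fv⊆ ck-app (inj₂ (inj₂ h))   = inj₂ h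
⟶-fv⊆ ck-val (inj₁ h)          = inj₂ h
⟶-fv⊆ ck-val (inj₂ h)          = inj₁ h
⟶-fv⊆ ck-arg (inj₁ h)          = inj₁ (inj₁ h)
⟶-fv⊆ ck-arg (inj₂ (inj₁ h))   = inj₂ h
⟶-fv⊆ ck-arg (inj₂ (inj₂ h))   = inj₁ (inj₂ h)
⟶-fv⊆ (ck-beta {t}) (inj₁ h) with sub-fv⊆ _ t h
... | inj₁ p        = inj₁ (inj₁ (inlam p))
... | inj₂ (zero , p) = inj₂ p
⟶-fv⊆ ck-beta (inj₂ h)         = inj₁ (inj₂ h)

⟶*-fv⊆ : ∀ {C D} → C ⟶* D → (_∈fvC D) ⊆ (_∈fvC C)
⟶*-fv⊆ ε        h = h
⟶*-fv⊆ (p ◅ ps) h = ⟶-fv⊆ p (⟶*-fv⊆ ps h)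

fv-answer⊆ : ∀ π {v} → (_∈fvS (fun v ∷ [])) ⊆ (_∈fvC cont π v)
fv-answer⊆ π (inj₁ h) = inj₂ h

fv-tail⊆ : ∀ φ {π v} → (_∈fvS π) ⊆ (_∈fvC cont (φ ∷ π) v)
fv-tail⊆ φ h = inj₁ (inj₂ h)

-- The NFB machine as the CK machine with a counter

infix 25 _at_

_at_ : Conf → ℕ → MState
ev t π   at n = mev t π n
cont π v at n = mcont π v n

at-τ : ∀ {C D} n → C ⟶ D → C at n —τ→ D at n
at-τ n ck-app  = m-app
at-τ n ck-val  = m-val
at-τ n ck-arg  = m-arg
at-τ n ck-beta = m-beta

at-τ* : ∀ {C D} n → C ⟶* D → C at n —τ*→ D at n
at-τ* n = gmap (_at n) (at-τ n)

at-τ⁻ : ∀ C n {X} → C at n —τ→ X → Σ Conf λ D → C ⟶ D × X ≡ D at n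
at-τ⁻ (ev t π)   n m-app  = _ , ck-app , refl
at-τ⁻ (ev t π)   n m-val  = _ , ck-val , refl
at-τ⁻ (cont π v) n m-arg  = _ , ck-arg , refl
at-τ⁻ (cont π v) n m-beta = _ , ck-beta , refl

at-τ*⁻ : ∀ C n {X} → C at n —τ*→ X → Σ Conf λ D → C ⟶* D × X ≡ D at n
at-τ*⁻ C n ε = C , ε , refl
at-τ*⁻ C n (p ◅ ps) with at-τ⁻ C n p
... | D , q , refl with at-τ*⁻ D n ps
... | E , qs , eq = E , q ◅ qs , eq

data FlagStep (n : ℕ) : Conf → Flag → MState → Set where
  λ-step   : ∀ {v} → FlagStep n (cont [] v) λF (mcont (fun v ∷ []) (vf n) (suc n))
  var-step : ∀ {f π v} → FlagStep n (cont (fun (vf f) ∷ π) v) (varF f) (mmid π v n)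

flagStep : ∀ D n {F X} → D at n —[ flag F ]→ X → FlagStep n D F X
flagStep (cont π v) n m-lam = λ-step
flagStep (cont π v) n m-var = var-step

mmid-τ* : ∀ {π v n Z} → mmid π v n —τ*→ Z → Z ≡ mmid π v n
mmid-τ* ε = refl

Below : ℕ → Pred ℕ 0ℓ → Set
Below n P = P ⊆ (_< n)

Below-fresh : ∀ {n} {P : Pred ℕ 0ℓ} → Below n P → ¬ P n
Below-fresh b h = <-irrefl refl (b h)

Below-hole : ∀ π {n} → Below n (_∈fvS π) → Below (suc n) (_∈fvC cont π (vf n))
Below-hole π     b (inj₁ h)    = m<n⇒m<1+n (b h)
Below-hole π {n} b (inj₂ here) = n<1+n n

Below-answer-hole : ∀ π {n v} → Below n (_∈fvC cont π v) → Below (suc n) (_∈fvC cont (fun v ∷ []) (vf n))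
Below-answer-hole π b = Below-hole (fun _ ∷ []) (λ h → b (fv-answer⊆ π h))

Below-tail-hole : ∀ φ {n π v} → Below n (_∈fvC cont (φ ∷ π) v) → Below (suc n) (_∈fvC cont π (vf n))
Below-tail-hole φ b = Below-hole _ (λ h → b (fv-tail⊆ φ h))

Below-⟶* : ∀ {n C D} → Below n (_∈fvC C) → C ⟶* D → Below n (_∈fvC D)
Below-⟶* b C↠D h = b (⟶*-fv⊆ C↠D h)

fvBound : ∀ {k} → Tm k → ℕ
fvBound (fvar f)  = suc f
fvBound (bvar i)  = 0
fvBound (lam t)   = fvBound t
fvBound (app t s) = fvBound t ⊔ fvBound s

Below-fvBound : ∀ {k} (t : Tm k) → Below (fvBound t) (_∈fvTm t)
Below-fvBound (fvar f)  here      = n<1+n f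
Below-fvBound (lam t)   (inlam h) = Below-fvBound t h
Below-fvBound (app t s) (appl h)  = <-≤-trans (Below-fvBound t h) (m≤m⊔n (fvBound t) (fvBound s))
Below-fvBound (app t s) (appr h)  = <-≤-trans (Below-fvBound s h) (m≤n⊔m (fvBound t) (fvBound s))

-- From normal-form bisimulations to machine bisimulations

module ToMachine (_R_ : Conf → Conf → Set) (isNF : IsNFBisim _R_) where
  open IsNFBisim isNF

  data _S_ : MState → MState → Set where
    conf : ∀ {C C' n} → Below n (_∈fvC C) → Below n (_∈fvC C') → C R C' → (C at n) S (C' at n)
    -- after the variable flag the opponent may still choose to test the
    -- argument (val) or the context (ctx), so both clause-(2) pairs are kept
    mid  : ∀ {f f' π v π' v' n} →
      Below n (_∈fvC cont (fun (vf f) ∷ π) v) → Below n (_∈fvC cont (fun (vf f') ∷ π') v') →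
      cont (fun v ∷ []) (vf n) R cont (fun v' ∷ []) (vf n) → cont π (vf n) R cont π' (vf n) →
      mmid π v n S mmid π' v' n

  S-symmetric : Symmetric _S_
  S-symmetric (conf b b' r)     = conf b' b (symm r)
  S-symmetric (mid b b' r₁ r₂)  = mid b' b (symm r₁) (symm r₂)

  S-step : ∀ {X Y F X'} → X S Y → X ⇒[ F ] X' → Σ MState λ Y' → Y ⇒[ F ] Y' × X' S Y'
  S-step (conf {C} {C'} {n} bC bC' r) (_ , τs , fl) with at-τ*⁻ C n τs
  ... | D , C↠D , refl with flagStep D n fl
  ... | λ-step with clause1 r C↠D
  ...   | _ , C'↠D' , next-related =
    _ , (_ , at-τ* n C'↠D' , m-lam) ,
    conf (Below-answer-hole [] bD) (Below-answer-hole [] bD')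
         (next-related n (Below-fresh bC , Below-fresh bC' , Below-fresh bD , Below-fresh bD' , tt))
    where
    bD  = Below-⟶* bC C↠D
    bD' = Below-⟶* bC' C'↠D'
  S-step (conf {C} {C'} {n} bC bC' r) (_ , τs , fl) | D , C↠D , refl | var-step with clause2 r C↠D
  ...   | _ , _ , C'↠D' , next-related =
    _ , (_ , at-τ* n C'↠D' , m-var) , mid bD bD' r₁ r₂
    where
    bD  = Below-⟶* bC C↠D
    bD' = Below-⟶* bC' C'↠D'
    r₁r₂ = next-related n (Below-fresh bC , Below-fresh bC' , Below-fresh bD , Below-fresh bD' , tt)
    r₁ = proj₁ r₁r₂
    r₂ = proj₂ r₁r₂
  S-step (mid {f} {f'} b b' r₁ r₂) (_ , τs , fl) with mmid-τ* τs
  ... | refl with fl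
  ... | m-fval = _ , (_ , ε , m-fval) , conf (Below-answer-hole (fun (vf f) ∷ _) b) (Below-answer-hole (fun (vf f') ∷ _) b') r₁
  ... | m-fctx = _ , (_ , ε , m-fctx) ,
    conf (Below-tail-hole (fun (vf f)) b) (Below-tail-hole (fun (vf f')) b') r₂

  S-isMBisim : IsMBisim _S_
  S-isMBisim = record { symm = S-symmetric ; step = S-step ; final = λ { _ (_ , _ , ()) } }

nf⇒machine : ∀ t s → t ≈nf s → Σ ℕ λ n → AboveFV n t s × (mev t [] n ≈m mev s [] n)
nf⇒machine t s (R , isNF , r) =
  n , above , _S_ , S-isMBisim ,
  conf (λ { (inj₁ h) → above _ (inj₁ h) }) (λ { (inj₁ h) → above _ (inj₂ h) }) r
  where
  open ToMachine R isNF
  n = fvBound t ⊔ fvBound s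
  above : AboveFV n t s
  above x (inj₁ h) = <-≤-trans (Below-fvBound t h) (m≤m⊔n (fvBound t) (fvBound s))
  above x (inj₂ h) = <-≤-trans (Below-fvBound s h) (m≤n⊔m (fvBound t) (fvBound s))

-- From machine bisimulations to normal-form bisimulations

record InjectiveBelow (ρ : ℕ → ℕ) (n : ℕ) (P : Pred ℕ 0ℓ) : Set where
  field
    bounded   : ∀ {x} → P x → ρ x < n
    injective : ∀ {x y} → P x → P y → ρ x ≡ ρ y → x ≡ y

InjectiveBelow-⊆ : ∀ {ρ n} {P Q : Pred ℕ 0ℓ} → Q ⊆ P → InjectiveBelow ρ n P → InjectiveBelow ρ n Q
InjectiveBelow-⊆ Q⊆P g = record
  { bounded   = λ q → bounded (Q⊆P q)
  ; injective = λ qx qy → injective (Q⊆P qx) (Q⊆P qy)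
  }
  where open InjectiveBelow g

_[_↦_] : (ℕ → ℕ) → ℕ → ℕ → ℕ → ℕ
(ρ [ f ↦ n ]) x with x ≟ f
... | yes _ = n
... | no _  = ρ x

[↦]-≡ : ∀ ρ f n → (ρ [ f ↦ n ]) f ≡ n
[↦]-≡ ρ f n with f ≟ f
... | yes _ = refl
... | no f≢f = ⊥-elim (f≢f refl)

[↦]-≢ : ∀ {ρ f n x} → x ≢ f → (ρ [ f ↦ n ]) x ≡ ρ x
[↦]-≢ {f = f} {x = x} x≢f with x ≟ f
... | yes x≡f = ⊥-elim (x≢f x≡f)
... | no _    = refl

InjectiveBelow-[↦] : ∀ {ρ n f} {P Q : Pred ℕ 0ℓ} → InjectiveBelow ρ n P →
  (∀ {x} → Q x → x ≡ f ⊎ (P x × x ≢ f)) → InjectiveBelow (ρ [ f ↦ n ]) (suc n) Q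
InjectiveBelow-[↦] {ρ} {n} {f} {P} {Q} g classify = record { bounded = bounded ; injective = injective }
  where
  open InjectiveBelow g renaming (bounded to ρ-bounded; injective to ρ-injective)
  bounded : ∀ {x} → Q x → (ρ [ f ↦ n ]) x < suc n
  bounded q with classify q
  ... | inj₁ refl       = subst (_< suc n) (sym ([↦]-≡ ρ f n)) (n<1+n n)
  ... | inj₂ (p , x≢f)  = subst (_< suc n) (sym ([↦]-≢ x≢f)) (m<n⇒m<1+n (ρ-bounded p))
  new≢old : ∀ {y} → P y → y ≢ f → (ρ [ f ↦ n ]) f ≢ (ρ [ f ↦ n ]) y
  new≢old p y≢f eq = <-irrefl (trans (sym (trans eq ([↦]-≢ y≢f))) ([↦]-≡ ρ f n)) (ρ-bounded p)
  injective : ∀ {x y} → Q x → Q y → (ρ [ f ↦ n ]) x ≡ (ρ [ f ↦ n ]) y → x ≡ y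
  injective qx qy eq with classify qx | classify qy
  ... | inj₁ refl          | inj₁ refl          = refl
  ... | inj₁ refl          | inj₂ (py , y≢f)    = ⊥-elim (new≢old py y≢f eq)
  ... | inj₂ (px , x≢f)    | inj₁ refl          = ⊥-elim (new≢old px x≢f (sym eq))
  ... | inj₂ (px , x≢f)    | inj₂ (py , y≢f)    =
    ρ-injective px py (trans (sym ([↦]-≢ x≢f)) (trans eq ([↦]-≢ y≢f)))

hole-or-old : ∀ {P : Pred ℕ 0ℓ} {π f x} → (_∈fvS π) ⊆ P → ¬ f ∈fvS π →
  x ∈fvC cont π (vf f) → x ≡ f ⊎ (P x × x ≢ f)
hole-or-old π⊆P f∉π (inj₁ h)    = inj₂ (π⊆P h , λ { refl → f∉π h })
hole-or-old π⊆P f∉π (inj₂ here) = inj₁ refl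

renameConf-[↦]-hole : ∀ ρ f n π → ¬ f ∈fvS π →
  renameConf (ρ [ f ↦ n ]) (cont π (vf f)) ≡ cont (renameStack ρ π) (vf n)
renameConf-[↦]-hole ρ f n π f∉π =
  cong₂ cont (renameStack-cong π (λ h → [↦]-≢ {ρ} {f} {n} (λ { refl → f∉π h }))) (cong vf ([↦]-≡ ρ f n))

module FromMachine (_R_ : MState → MState → Set) (isM : IsMBisim _R_) where
  open IsMBisim isM

  _∼_ : Conf → Conf → Set
  C ∼ C' = Σ (ℕ → ℕ) λ ρ → Σ ℕ λ n →
    InjectiveBelow ρ n ((_∈fvC C) ∪ (_∈fvC C')) × (renameConf ρ C at n) R (renameConf ρ C' at n)

  ∼-symmetric : Symmetric _∼_
  ∼-symmetric (ρ , n , g , r) = ρ , n , InjectiveBelow-⊆ swap g , symm r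

  plug-fresh : ∀ {ρ n C C' D D' π π' f} →
    InjectiveBelow ρ n ((_∈fvC C) ∪ (_∈fvC C')) → C ⟶* D → C' ⟶* D' →
    (_∈fvS π) ⊆ (_∈fvC D) → (_∈fvS π') ⊆ (_∈fvC D') → ¬ f ∈fvC D → ¬ f ∈fvC D' →
    mcont (renameStack ρ π) (vf n) (suc n) R mcont (renameStack ρ π') (vf n) (suc n) →
    cont π (vf f) ∼ cont π' (vf f)
  plug-fresh {ρ} {n} {C} {C'} {π = π} {π'} {f} g C↠D C'↠D' π⊆D π'⊆D' f∉D f∉D' r =
    ρ [ f ↦ n ] , suc n , InjectiveBelow-[↦] g classify ,
    subst₂ (λ X Y → (X at suc n) R (Y at suc n))
      (sym (renameConf-[↦]-hole ρ f n π f∉π)) (sym (renameConf-[↦]-hole ρ f n π' f∉π')) r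
    where
    f∉π : ¬ f ∈fvS π
    f∉π h = f∉D (π⊆D h)
    f∉π' : ¬ f ∈fvS π'
    f∉π' h = f∉D' (π'⊆D' h)
    classify : ∀ {x} → x ∈fvC cont π (vf f) ⊎ x ∈fvC cont π' (vf f) →
      x ≡ f ⊎ ((x ∈fvC C ⊎ x ∈fvC C') × x ≢ f)
    classify (inj₁ h) = hole-or-old {(_∈fvC C) ∪ (_∈fvC C')} (λ h → inj₁ (⟶*-fv⊆ C↠D (π⊆D h))) f∉π h
    classify (inj₂ h) = hole-or-old {(_∈fvC C) ∪ (_∈fvC C')} (λ h → inj₂ (⟶*-fv⊆ C'↠D' (π'⊆D' h))) f∉π' h

  mmid-val : ∀ {π v π' v' n} → mmid π v n R mmid π' v' n →
    mcont (fun v ∷ []) (vf n) (suc n) R mcont (fun v' ∷ []) (vf n) (suc n)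
  mmid-val r with step r (_ , ε , m-fval)
  ... | _ , (_ , τs , fl) , r' with mmid-τ* τs
  ... | refl with fl
  ... | m-fval = r'

  mmid-ctx : ∀ {π v π' v' n} → mmid π v n R mmid π' v' n →
    mcont π (vf n) (suc n) R mcont π' (vf n) (suc n)
  mmid-ctx r with step r (_ , ε , m-fctx)
  ... | _ , (_ , τs , fl) , r' with mmid-τ* τs
  ... | refl with fl
  ... | m-fctx = r'

  ∼-clause1 : ∀ {C C' v} → C ∼ C' → C ⟶* cont [] v →
    Σ Val λ v' → (C' ⟶* cont [] v') ×
      (∀ f → FreshC f (C ∷ C' ∷ cont [] v ∷ cont [] v' ∷ []) →
         cont (fun v ∷ []) (vf f) ∼ cont (fun v' ∷ []) (vf f))
  ∼-clause1 {C' = C'} (ρ , n , g , r) C↠ with step r (_ , at-τ* n (renameConf-⟶* ρ C↠) , m-lam)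
  ... | _ , (_ , τs , fl) , r' with at-τ*⁻ (renameConf ρ C') n τs
  ... | D , ρC'↠D , refl with flagStep D n fl
  ... | λ-step with renameConf-⟶*⁻ ρ C' ρC'↠D
  ... | D₀ , C'↠D₀ , eq with renameConf-≡-answer ρ D₀ eq
  ... | v' , refl , refl = v' , C'↠D₀ , λ { f (_ , _ , f∉D , f∉D' , _) →
    plug-fresh g C↠ C'↠D₀ (fv-answer⊆ []) (fv-answer⊆ []) f∉D f∉D' r' }

  ∼-clause2 : ∀ {C C' f π v} → C ∼ C' → C ⟶* cont (fun (vf f) ∷ π) v →
    Σ Stack λ π' → Σ Val λ v' → (C' ⟶* cont (fun (vf f) ∷ π') v') ×
      (∀ f' → FreshC f' (C ∷ C' ∷ cont (fun (vf f) ∷ π) v ∷ cont (fun (vf f) ∷ π') v' ∷ []) →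
         cont (fun v ∷ []) (vf f') ∼ cont (fun v' ∷ []) (vf f') × cont π (vf f') ∼ cont π' (vf f'))
  ∼-clause2 {C' = C'} (ρ , n , g , r) C↠ with step r (_ , at-τ* n (renameConf-⟶* ρ C↠) , m-var)
  ... | _ , (_ , τs , fl) , r' with at-τ*⁻ (renameConf ρ C') n τs
  ... | D , ρC'↠D , refl with flagStep D n fl
  ... | var-step with renameConf-⟶*⁻ ρ C' ρC'↠D
  ... | D₀ , C'↠D₀ , eq with renameConf-≡-var-app ρ D₀ eq
  ... | h , π' , v' , refl , ρh≡ρf , refl , refl
    with InjectiveBelow.injective g (inj₂ (⟶*-fv⊆ C'↠D₀ (inj₁ (inj₁ here))))
                                    (inj₁ (⟶*-fv⊆ C↠ (inj₁ (inj₁ here)))) ρh≡ρf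
  ... | refl = π' , v' , C'↠D₀ , λ { f' (_ , _ , f∉D , f∉D' , _) →
    plug-fresh g C↠ C'↠D₀ (fv-answer⊆ (fun (vf _) ∷ _)) (fv-answer⊆ (fun (vf _) ∷ _)) f∉D f∉D' (mmid-val r') ,
    plug-fresh g C↠ C'↠D₀ (fv-tail⊆ (fun (vf _))) (fv-tail⊆ (fun (vf _))) f∉D f∉D' (mmid-ctx r') }

  ∼-isNFBisim : IsNFBisim _∼_
  ∼-isNFBisim = record { symm = ∼-symmetric ; clause1 = ∼-clause1 ; clause2 = ∼-clause2 }

machine⇒nf : ∀ t s → (Σ ℕ λ n → AboveFV n t s × (mev t [] n ≈m mev s [] n)) → t ≈nf s
machine⇒nf t s (n , above , R , isM , r) =
  _∼_ , ∼-isNFBisim ,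
  (λ x → x) , n ,
  record { bounded = λ { (inj₁ (inj₁ h)) → above _ (inj₁ h) ; (inj₂ (inj₁ h)) → above _ (inj₂ h) }
         ; injective = λ _ _ eq → eq } ,
  subst₂ (λ t' s' → R (mev t' [] n) (mev s' [] n)) (sym (renameTm-id t)) (sym (renameTm-id s)) r
  where open FromMachine R isM

theorem6p3 : (t s : Term) →
    (t ≈nf s) ⇔ (Σ ℕ λ n → AboveFV n t s × (mev t [] n ≈m mev s [] n))
theorem6p3 t s = mk⇔ (nf⇒machine t s) (machine⇒nf t s)
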